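{- There exists $\alpha_0>0$ such that for every $\alpha\in(0,\alpha_0]$ there is $\tau_0>0$ such that for every $\tau\in(0,\tau_0]$ there is $\nu_0>0$ such that for every $\nu\in(0,\nu_0]$ there is $n_0$ such that the following holds for all $n\geq n_0$. Let $G$ be a digraph on $n$ vertices with $e(G) \ge (\alpha -\nu) n^2$ and $\Delta^0(G) \le \alpha n$. If $G$ is not a robust $(\nu,\tau)$-outexpander, then $G$ admits a $(4,\tau,4\nu)$-partition.
   Context: A digraph is a finite directed graph without loops, with at most one edge from $a$ to $b$ for each ordered pair of distinct vertices. $\Delta^0(G)$ is the maximum over all vertices of the maximum of outdegree and indegree. For $S\subseteq V(G)$, $\mathrm{RN}^+_\nu(S)=\{v\in V(G): |N^-(v)\cap S|\geq \nu n\}$, where $N^-(v)$ is the set of inneighbours of $v$; $G$ is a robust $(\nu,\tau)$-outexpander if $|\mathrm{RN}^+_\nu(S)|\geq |S|+\nu n$ for all $S\subseteq V(G)$ with $\tau n\leq |S|\leq (1-\tau)n$. A $4$-partition is a partition $\{V_{ij}:i,j\in[2]\}$ of $V(G)$ (parts may be empty); write $V_{i*}=V_{i1}\cup V_{i2}$, $V_{*j}=V_{1j}\cup V_{2j}$; $E(A,B)$ is the set of edges $ab$ with $a\in A,b\in B$. It is a $(4,\tau,\gamma)$-partition if $|E(V_{1*},V_{*2})\cup E(V_{2*},V_{*1})|\leq \gamma n^2$ and $|V_{i*}|,|V_{*j}|\geq \tau n$ for all $i,j\in[2]$.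
   Formalization: The parameters α, τ and ν range only over the rationals, and the thresholds α₀, τ₀ and ν₀ are taken in ℚ as well. -}

module Defs where

open import Data.Nat using (ℕ; zero; suc; _+_)
open import Data.Bool using (Bool; true; false; _∧_; _∨_; if_then_else_)
open import Data.Fin using (Fin; zero; suc)
open import Data.Fin.Properties using () renaming (_≟_ to _≟F_)
open import Data.Product using (_×_; _,_; proj₁; proj₂)
open import Data.Integer using (+_)
open import Data.Rational using (ℚ; _/_; _≤_; _≤?_; _*_; _-_; 1ℚ) renaming (_+_ to _+ℚ_)
open import Relation.Binary.PropositionalEquality using (_≡_)
open import Relation.Nullary.Decidable using (⌊_⌋)

ℕ→ℚ : ℕ → ℚ
ℕ→ℚ k = (+ k) / 1

count : ∀ {n} → (Fin n → Bool) → ℕ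
count {zero}  P = 0
count {suc n} P = (if P zero then 1 else 0) + count (λ i → P (suc i))

-- a digraph on vertex set Fin n: adjacency a b = true iff edge a → b; no loops.
-- (At most one edge per ordered pair is automatic.)
record Digraph (n : ℕ) : Set where
  field
    adj      : Fin n → Fin n → Bool
    loopless : ∀ v → adj v v ≡ false
open Digraph public

VSet : ℕ → Set
VSet n = Fin n → Bool

setSize : ∀ {n} → VSet n → ℕ
setSize S = count S

sumF : ∀ {n} → (Fin n → ℕ) → ℕ
sumF {zero}  f = 0
sumF {suc n} f = f zero + sumF (λ i → f (suc i))

countPairs : ∀ {n} → (Fin n → Fin n → Bool) → ℕ
countPairs R = sumF (λ a → count (R a))

edgeCount : ∀ {n} → Digraph n → ℕ
edgeCount G = countPairs (adj G)

outdeg : ∀ {n} → Digraph n → Fin n → ℕ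
outdeg G v = count (λ b → adj G v b)

indeg : ∀ {n} → Digraph n → Fin n → ℕ
indeg G v = count (λ a → adj G a v)

MaxSemiDegLe : ∀ {n} → Digraph n → ℚ → Set
MaxSemiDegLe G x = ∀ v → (ℕ→ℚ (outdeg G v) ≤ x) × (ℕ→ℚ (indeg G v) ≤ x)

inNbrsIn : ∀ {n} → Digraph n → VSet n → Fin n → ℕ
inNbrsIn G S v = count (λ a → adj G a v ∧ S a)

RN⁺ : ∀ {n} → Digraph n → ℚ → VSet n → VSet n
RN⁺ {n} G ν S v = ⌊ ν * ℕ→ℚ n ≤? ℕ→ℚ (inNbrsIn G S v) ⌋

RobustOutexpander : ∀ {n} → Digraph n → ℚ → ℚ → Set
RobustOutexpander {n} G ν τ =
  (S : VSet n) → τ * ℕ→ℚ n ≤ ℕ→ℚ (setSize S) → ℕ→ℚ (setSize S) ≤ (1ℚ - τ) * ℕ→ℚ n →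
  ℕ→ℚ (setSize S) +ℚ ν * ℕ→ℚ n ≤ ℕ→ℚ (setSize (RN⁺ G ν S))

-- a 4-partition {V_ij : i,j ∈ [2]}: each vertex is assigned its part index (i , j)
-- (parts may be empty). Index 1 is Fin.zero, index 2 is Fin.suc Fin.zero.
FourPartition : ℕ → Set
FourPartition n = Fin n → Fin 2 × Fin 2

rowPart : ∀ {n} → FourPartition n → Fin 2 → VSet n
rowPart P i v = ⌊ proj₁ (P v) ≟F i ⌋

colPart : ∀ {n} → FourPartition n → Fin 2 → VSet n
colPart P j v = ⌊ proj₂ (P v) ≟F j ⌋

one two : Fin 2
one = zero
two = suc zero

crossEdges : ∀ {n} → Digraph n → FourPartition n → ℕ
crossEdges G P = countPairs (λ a b →
  adj G a b ∧ ((rowPart P one a ∧ colPart P two b) ∨ (rowPart P two a ∧ colPart P one b)))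

Is4Partition : ∀ {n} → Digraph n → ℚ → ℚ → FourPartition n → Set
Is4Partition {n} G τ γ P =
  (ℕ→ℚ (crossEdges G P) ≤ γ * (ℕ→ℚ n * ℕ→ℚ n)) ×
  (∀ i → τ * ℕ→ℚ n ≤ ℕ→ℚ (setSize (rowPart P i))) ×
  (∀ j → τ * ℕ→ℚ n ≤ ℕ→ℚ (setSize (colPart P j)))

module Submission where

-- Let S witness that G is not a robust outexpander and R = RN⁺_ν(S), so |R| < |S| + νn.
-- Few edges go from S to the complement of R, since every vertex outside R has fewer than
-- νn in-neighbours in S.  Counting edges by whether their tail lies in S and their head in R,
-- the semidegree bound Δ⁰ ≤ αn against e(G) ≥ (α − ν)n² leaves room for only about νn² edges
-- from the complement of S into R either.  Hence S and R are the first row and column of a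
-- 4-partition with at most 4νn² crossing edges, and the same inequalities keep R and its
-- complement of size at least τn once τ ≤ α/4 and ν ≤ τα/8.

open import Defs
open import Data.Nat using (ℕ)
open import Data.Product using (Σ; ∃; _×_)
open import Data.Rational using (ℚ; _≤_; _<_; _-_; _*_; 0ℚ)
open import Data.Empty using () renaming (⊥ to ⊥')
open import Data.Nat using () renaming (_≤_ to _≤ℕ_)

open import Data.Bool using (Bool; true; false; _∧_; _∨_; not; if_then_else_)
open import Data.Bool.Properties using (∧-assoc; ∧-comm; ∧-identityʳ; ∧-zeroʳ)
open import Data.Empty using (⊥-elim)
open import Data.Fin using (Fin; zero; suc)
open import Data.Fin.Properties using () renaming (_≟_ to _≟F_)
open import Data.Fin.Subset.Properties using (anySubset?)
open import Data.Integer as ℤ using (+_)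
import Data.Integer.Properties as ℤ
open import Data.Nat as ℕ using (zero; suc)
import Data.Nat.Properties as ℕ
open import Algebra.Properties.CommutativeSemigroup ℕ.+-commutativeSemigroup
  using () renaming (interchange to +-interchange)
open import Data.Product using (_,_; proj₁; proj₂)
open import Data.Rational using (1ℚ; _+_; -_; _/_; _≤?_; _<?_; toℚᵘ; nonNegative; positive)
open import Data.Rational.Properties
open import Data.Rational.Solver using (module +-*-Solver)
open +-*-Solver using (solve; _:+_; _:-_; _:*_; _:=_; con)
import Data.Rational.Unnormalised as ℚᵘ
import Data.Rational.Unnormalised.Properties as ℚᵘ
open import Data.Vec using (lookup; tabulate)
open import Data.Vec.Properties using (lookup∘tabulate)
open import Function using (_∘_)
open import Relation.Binary.PropositionalEquality
open import Relation.Nullary using (Dec; yes; no; ¬_)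
open import Relation.Nullary.Decidable using (⌊_⌋; _×-dec_)

count-cong : ∀ {m} {P Q : Fin m → Bool} → (∀ i → P i ≡ Q i) → count P ≡ count Q
count-cong {zero}  P≗Q = refl
count-cong {suc m} P≗Q = cong₂ (λ b k → (if b then 1 else 0) ℕ.+ k) (P≗Q zero) (count-cong (P≗Q ∘ suc))

count-split : ∀ {m} (P Q : Fin m → Bool) →
  count P ≡ count (λ i → P i ∧ Q i) ℕ.+ count (λ i → P i ∧ not (Q i))
count-split {zero}  P Q = refl
count-split {suc m} P Q with P zero | Q zero | count-split (P ∘ suc) (Q ∘ suc)
... | false | _     | ih = ih
... | true  | true  | ih = cong suc ih
... | true  | false | ih = trans (cong suc ih) (sym (ℕ.+-suc _ _))

count-true : ∀ {m} → count {m} (λ _ → true) ≡ m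
count-true {zero}  = refl
count-true {suc m} = cong suc (count-true {m})

count-complement : ∀ {m} (Q : Fin m → Bool) → count Q ℕ.+ count (not ∘ Q) ≡ m
count-complement Q = trans (sym (count-split (λ _ → true) Q)) count-true

count-mono : ∀ {m} {P Q : Fin m → Bool} → (∀ i → P i ≡ true → Q i ≡ true) → count P ℕ.≤ count Q
count-mono {zero}          P⇒Q = ℕ.z≤n
count-mono {suc m} {P} {Q} P⇒Q with P zero | Q zero | P⇒Q zero | count-mono {P = P ∘ suc} {Q ∘ suc} (P⇒Q ∘ suc)
... | false | false | _   | ih = ih
... | false | true  | _   | ih = ℕ.m≤n⇒m≤1+n ih
... | true  | true  | _   | ih = ℕ.s≤s ih
... | true  | false | P⇒Q | ih with () ← P⇒Q refl

count≤size : ∀ {m} (P : Fin m → Bool) → count P ℕ.≤ m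
count≤size {m} P = subst (count P ℕ.≤_) (count-true {m}) (count-mono {m} {P} {λ _ → true} (λ _ _ → refl))

count-∧-const : ∀ {m} (P : Fin m → Bool) b → count (λ i → P i ∧ b) ≡ (if b then count P else 0)
count-∧-const     P true  = count-cong (λ i → ∧-identityʳ (P i))
count-∧-const {m} P false = trans (count-cong (λ i → ∧-zeroʳ (P i))) (count-false {m})
  where
  count-false : ∀ {m} → count {m} (λ _ → false) ≡ 0
  count-false {zero}  = refl
  count-false {suc m} = count-false {m}

sumF-cong : ∀ {m} {f g : Fin m → ℕ} → (∀ i → f i ≡ g i) → sumF f ≡ sumF g
sumF-cong {zero}  f≗g = refl
sumF-cong {suc m} f≗g = cong₂ ℕ._+_ (f≗g zero) (sumF-cong (f≗g ∘ suc))

sumF-+ : ∀ {m} (f g : Fin m → ℕ) → sumF (λ i → f i ℕ.+ g i) ≡ sumF f ℕ.+ sumF g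
sumF-+ {zero}  f g = refl
sumF-+ {suc m} f g = begin
  (f zero ℕ.+ g zero) ℕ.+ sumF (λ i → f (suc i) ℕ.+ g (suc i))
    ≡⟨ cong ((f zero ℕ.+ g zero) ℕ.+_) (sumF-+ (f ∘ suc) (g ∘ suc)) ⟩
  (f zero ℕ.+ g zero) ℕ.+ (sumF (f ∘ suc) ℕ.+ sumF (g ∘ suc))
    ≡⟨ +-interchange (f zero) (g zero) _ _ ⟩
  sumF f ℕ.+ sumF g ∎
  where open ≡-Reasoning

sumF-zero : ∀ {m} → sumF {m} (λ _ → 0) ≡ 0
sumF-zero {zero}  = refl
sumF-zero {suc m} = sumF-zero {m}

sumF-comm : ∀ {m k} (f : Fin m → Fin k → ℕ) →
  sumF (λ a → sumF (λ b → f a b)) ≡ sumF (λ b → sumF (λ a → f a b))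
sumF-comm {zero}  {k} f = sym (sumF-zero {k})
sumF-comm {suc m} {k} f = trans (cong (sumF (f zero) ℕ.+_) (sumF-comm (f ∘ suc)))
  (sym (sumF-+ (f zero) (λ b → sumF (λ a → f (suc a) b))))

count≡sumF-indicator : ∀ {m} (P : Fin m → Bool) → count P ≡ sumF (λ i → if P i then 1 else 0)
count≡sumF-indicator {zero}  P = refl
count≡sumF-indicator {suc m} P = cong ((if P zero then 1 else 0) ℕ.+_) (count≡sumF-indicator (P ∘ suc))

countPairs-cong : ∀ {m} {P Q : Fin m → Fin m → Bool} → (∀ a b → P a b ≡ Q a b) → countPairs P ≡ countPairs Q
countPairs-cong P≗Q = sumF-cong (λ a → count-cong (P≗Q a))

countPairs-split : ∀ {m} (P Q : Fin m → Fin m → Bool) →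
  countPairs P ≡ countPairs (λ a b → P a b ∧ Q a b) ℕ.+ countPairs (λ a b → P a b ∧ not (Q a b))
countPairs-split P Q = trans (sumF-cong (λ a → count-split (P a) (Q a)))
  (sumF-+ (λ a → count (λ b → P a b ∧ Q a b)) (λ a → count (λ b → P a b ∧ not (Q a b))))

countPairs-transpose : ∀ {m} (P : Fin m → Fin m → Bool) → countPairs P ≡ sumF (λ b → count (λ a → P a b))
countPairs-transpose P = begin
  sumF (λ a → count (P a))                              ≡⟨ sumF-cong (λ a → count≡sumF-indicator (P a)) ⟩
  sumF (λ a → sumF (λ b → if P a b then 1 else 0))      ≡⟨ sumF-comm (λ a b → if P a b then 1 else 0) ⟩
  sumF (λ b → sumF (λ a → if P a b then 1 else 0))      ≡⟨ sumF-cong (λ b → sym (count≡sumF-indicator (λ a → P a b))) ⟩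
  sumF (λ b → count (λ a → P a b))                      ∎
  where open ≡-Reasoning

countPairs-∧-source : ∀ {m} (P : Fin m → Fin m → Bool) (X : Fin m → Bool) →
  countPairs (λ a b → P a b ∧ X a) ≡ sumF (λ a → if X a then count (P a) else 0)
countPairs-∧-source P X = sumF-cong (λ a → count-∧-const (P a) (X a))

countPairs-∧-target : ∀ {m} (P : Fin m → Fin m → Bool) (Y : Fin m → Bool) →
  countPairs (λ a b → P a b ∧ Y b) ≡ sumF (λ b → if Y b then count (λ a → P a b) else 0)
countPairs-∧-target P Y = trans (countPairs-transpose (λ a b → P a b ∧ Y b))
  (sumF-cong (λ b → count-∧-const (λ a → P a b) (Y b)))

ℕ→ℚ-+ : ∀ m k → ℕ→ℚ (m ℕ.+ k) ≡ ℕ→ℚ m + ℕ→ℚ k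
ℕ→ℚ-+ m k = toℚᵘ-injective (begin
  toℚᵘ (ℕ→ℚ (m ℕ.+ k))                       ≈⟨ toℚᵘ-fromℚᵘ (ℚᵘ.mkℚᵘ (+ (m ℕ.+ k)) 0) ⟩
  ℚᵘ.mkℚᵘ (+ (m ℕ.+ k)) 0                    ≈⟨ ℚᵘ.*≡* integral-sum ⟩
  ℚᵘ.mkℚᵘ (+ m) 0 ℚᵘ.+ ℚᵘ.mkℚᵘ (+ k) 0       ≈⟨ ℚᵘ.+-cong (toℚᵘ-fromℚᵘ (ℚᵘ.mkℚᵘ (+ m) 0)) (toℚᵘ-fromℚᵘ (ℚᵘ.mkℚᵘ (+ k) 0)) ⟨
  toℚᵘ (ℕ→ℚ m) ℚᵘ.+ toℚᵘ (ℕ→ℚ k)             ≈⟨ toℚᵘ-homo-+ (ℕ→ℚ m) (ℕ→ℚ k) ⟨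
  toℚᵘ (ℕ→ℚ m + ℕ→ℚ k)                       ∎)
  where
  open ℚᵘ.≃-Reasoning
  integral-sum : + (m ℕ.+ k) ℤ.* + 1 ≡ (+ m ℤ.* + 1 ℤ.+ + k ℤ.* + 1) ℤ.* + 1
  integral-sum rewrite ℤ.*-identityʳ (+ m) | ℤ.*-identityʳ (+ k) = cong (ℤ._* + 1) (ℤ.pos-+ m k)

ℕ→ℚ-nonNeg : ∀ m → 0ℚ ≤ ℕ→ℚ m
ℕ→ℚ-nonNeg m = nonNegative⁻¹ _ {{normalize-nonNeg m 1}}

ℕ→ℚ-mono : ∀ {m k} → m ℕ.≤ k → ℕ→ℚ m ≤ ℕ→ℚ k
ℕ→ℚ-mono {m} {k} m≤k = begin
  ℕ→ℚ m                       ≡⟨ +-identityʳ (ℕ→ℚ m) ⟨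
  ℕ→ℚ m + 0ℚ                  ≤⟨ +-monoʳ-≤ (ℕ→ℚ m) (ℕ→ℚ-nonNeg (k ℕ.∸ m)) ⟩
  ℕ→ℚ m + ℕ→ℚ (k ℕ.∸ m)       ≡⟨ ℕ→ℚ-+ m (k ℕ.∸ m) ⟨
  ℕ→ℚ (m ℕ.+ (k ℕ.∸ m))       ≡⟨ cong ℕ→ℚ (ℕ.m+[n∸m]≡n m≤k) ⟩
  ℕ→ℚ k                       ∎
  where open ≤-Reasoning

ℕ→ℚ-count-complement : ∀ {m} (Q : Fin m → Bool) → ℕ→ℚ (count (not ∘ Q)) ≡ ℕ→ℚ m - ℕ→ℚ (count Q)
ℕ→ℚ-count-complement {m} Q = begin
  ℕ→ℚ (count (not ∘ Q))                           ≡⟨ cancel (ℕ→ℚ (count Q)) _ ⟨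
  (ℕ→ℚ (count Q) + ℕ→ℚ (count (not ∘ Q))) - ℕ→ℚ (count Q)
                                                   ≡⟨ cong (_- ℕ→ℚ (count Q)) (ℕ→ℚ-+ (count Q) _) ⟨
  ℕ→ℚ (count Q ℕ.+ count (not ∘ Q)) - ℕ→ℚ (count Q) ≡⟨ cong (λ k → ℕ→ℚ k - ℕ→ℚ (count Q)) (count-complement Q) ⟩
  ℕ→ℚ m - ℕ→ℚ (count Q)                           ∎
  where
  open ≡-Reasoning
  cancel : ∀ x y → (x + y) - x ≡ y
  cancel = solve 2 (λ x y → (x :+ y) :- x := y) refl

sumF-indicator-≤ : ∀ {m} (X : Fin m → Bool) (f : Fin m → ℕ) (c : ℚ) →
  (∀ v → X v ≡ true → ℕ→ℚ (f v) ≤ c) →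
  ℕ→ℚ (sumF (λ v → if X v then f v else 0)) ≤ ℕ→ℚ (count X) * c
sumF-indicator-≤ {zero}  X f c f≤c = ≤-reflexive (sym (*-zeroˡ c))
sumF-indicator-≤ {suc m} X f c f≤c with X zero | f≤c zero
... | false | _      = sumF-indicator-≤ (X ∘ suc) (f ∘ suc) c (f≤c ∘ suc)
... | true  | f₀≤c   = begin
  ℕ→ℚ (f zero ℕ.+ sumF rest)                ≡⟨ ℕ→ℚ-+ (f zero) (sumF rest) ⟩
  ℕ→ℚ (f zero) + ℕ→ℚ (sumF rest)            ≤⟨ +-mono-≤ (f₀≤c refl) (sumF-indicator-≤ (X ∘ suc) (f ∘ suc) c (f≤c ∘ suc)) ⟩
  c + ℕ→ℚ (count (X ∘ suc)) * c             ≡⟨ cong (_+ ℕ→ℚ (count (X ∘ suc)) * c) (*-identityˡ c) ⟨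
  1ℚ * c + ℕ→ℚ (count (X ∘ suc)) * c        ≡⟨ *-distribʳ-+ c 1ℚ (ℕ→ℚ (count (X ∘ suc))) ⟨
  (1ℚ + ℕ→ℚ (count (X ∘ suc))) * c          ≡⟨ cong (_* c) (ℕ→ℚ-+ 1 (count (X ∘ suc))) ⟨
  ℕ→ℚ (suc (count (X ∘ suc))) * c           ∎
  where
  open ≤-Reasoning
  rest : Fin m → ℕ
  rest v = if X (suc v) then f (suc v) else 0

∁ : ∀ {n} → VSet n → VSet n
∁ X v = not (X v)

edgesBetween : ∀ {n} → Digraph n → VSet n → VSet n → ℕ
edgesBetween G X Y = countPairs (λ a b → (adj G a b ∧ X a) ∧ Y b)

edgesFrom : ∀ {n} → Digraph n → VSet n → ℕ
edgesFrom G X = countPairs (λ a b → adj G a b ∧ X a)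

edgesInto : ∀ {n} → Digraph n → VSet n → ℕ
edgesInto G Y = countPairs (λ a b → adj G a b ∧ Y b)

module _ {n : ℕ} (G : Digraph n) where

  edgeCount-split : ∀ X → ℕ→ℚ (edgeCount G) ≡ ℕ→ℚ (edgesFrom G X) + ℕ→ℚ (edgesFrom G (∁ X))
  edgeCount-split X = trans (cong ℕ→ℚ (countPairs-split (adj G) (λ a _ → X a)))
    (ℕ→ℚ-+ (edgesFrom G X) (edgesFrom G (∁ X)))

  edgesFrom-split : ∀ X Y → ℕ→ℚ (edgesFrom G X) ≡ ℕ→ℚ (edgesBetween G X Y) + ℕ→ℚ (edgesBetween G X (∁ Y))
  edgesFrom-split X Y = trans (cong ℕ→ℚ (countPairs-split (λ a b → adj G a b ∧ X a) (λ _ b → Y b)))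
    (ℕ→ℚ-+ (edgesBetween G X Y) (edgesBetween G X (∁ Y)))

  edgesInto-split : ∀ X Y → ℕ→ℚ (edgesInto G Y) ≡ ℕ→ℚ (edgesBetween G X Y) + ℕ→ℚ (edgesBetween G (∁ X) Y)
  edgesInto-split X Y = trans (cong ℕ→ℚ (trans (countPairs-split (λ a b → adj G a b ∧ Y b) (λ a _ → X a))
    (cong₂ ℕ._+_ (countPairs-cong (λ a b → swap (adj G a b) (Y b) (X a)))
                 (countPairs-cong (λ a b → swap (adj G a b) (Y b) (not (X a)))))))
    (ℕ→ℚ-+ (edgesBetween G X Y) (edgesBetween G (∁ X) Y))
    where
    swap : ∀ x y z → (x ∧ y) ∧ z ≡ (x ∧ z) ∧ y
    swap x y z = trans (∧-assoc x y z) (trans (cong (x ∧_) (∧-comm y z)) (sym (∧-assoc x z y)))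

  edgesFrom-≤ : ∀ {Δ} → MaxSemiDegLe G Δ → ∀ X → ℕ→ℚ (edgesFrom G X) ≤ ℕ→ℚ (setSize X) * Δ
  edgesFrom-≤ {Δ} Δ⁰≤Δ X = subst (λ k → ℕ→ℚ k ≤ ℕ→ℚ (setSize X) * Δ) (sym (countPairs-∧-source (adj G) X))
    (sumF-indicator-≤ X (outdeg G) Δ (λ v _ → proj₁ (Δ⁰≤Δ v)))

  edgesInto-≤ : ∀ {Δ} → MaxSemiDegLe G Δ → ∀ Y → ℕ→ℚ (edgesInto G Y) ≤ ℕ→ℚ (setSize Y) * Δ
  edgesInto-≤ {Δ} Δ⁰≤Δ Y = subst (λ k → ℕ→ℚ k ≤ ℕ→ℚ (setSize Y) * Δ) (sym (countPairs-∧-target (adj G) Y))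
    (sumF-indicator-≤ Y (indeg G) Δ (λ v _ → proj₂ (Δ⁰≤Δ v)))

  edgesBetween-≤ : ∀ X Y {c} → (∀ v → Y v ≡ true → ℕ→ℚ (inNbrsIn G X v) ≤ c) →
    ℕ→ℚ (edgesBetween G X Y) ≤ ℕ→ℚ (setSize Y) * c
  edgesBetween-≤ X Y {c} in≤c =
    subst (λ k → ℕ→ℚ k ≤ ℕ→ℚ (setSize Y) * c) (sym (countPairs-∧-target (λ a b → adj G a b ∧ X a) Y))
      (sumF-indicator-≤ Y (inNbrsIn G X) c in≤c)

  inNbrsIn-≤ : ∀ X v → inNbrsIn G X v ℕ.≤ setSize X
  inNbrsIn-≤ X v = count-mono (λ a → ∧-true-right (adj G a v) (X a))
    where
    ∧-true-right : ∀ x y → x ∧ y ≡ true → y ≡ true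
    ∧-true-right true y y≡true = y≡true

  edgesBetween-≤-product : ∀ X Y → ℕ→ℚ (edgesBetween G X Y) ≤ ℕ→ℚ (setSize Y) * ℕ→ℚ (setSize X)
  edgesBetween-≤-product X Y = edgesBetween-≤ X Y (λ v _ → ℕ→ℚ-mono (inNbrsIn-≤ X v))

  outside-RN⁺ : ∀ ν S v → ∁ (RN⁺ G ν S) v ≡ true → ℕ→ℚ (inNbrsIn G S v) ≤ ν * ℕ→ℚ n
  outside-RN⁺ ν S v with ν * ℕ→ℚ n ≤? ℕ→ℚ (inNbrsIn G S v)
  ... | yes _    = λ ()
  ... | no  ν≰in = λ _ → <⇒≤ (≰⇒> ν≰in)

side : Bool → Fin 2
side b = if b then one else two

side≟one : ∀ b → ⌊ side b ≟F one ⌋ ≡ b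
side≟one false = refl
side≟one true  = refl

side≟two : ∀ b → ⌊ side b ≟F two ⌋ ≡ not b
side≟two false = refl
side≟two true  = refl

quadrants : ∀ {n} → VSet n → VSet n → FourPartition n
quadrants X Y v = side (X v) , side (Y v)

crossEdges-quadrants : ∀ {n} (G : Digraph n) X Y →
  ℕ→ℚ (crossEdges G (quadrants X Y)) ≡ ℕ→ℚ (edgesBetween G X (∁ Y)) + ℕ→ℚ (edgesBetween G (∁ X) Y)
crossEdges-quadrants G X Y = trans (cong ℕ→ℚ (trans (countPairs-split _ (λ a _ → X a))
  (cong₂ ℕ._+_ (countPairs-cong (λ a b → from-X (adj G a b) (X a) (Y b)))
               (countPairs-cong (λ a b → from-∁X (adj G a b) (X a) (Y b))))))
  (ℕ→ℚ-+ (edgesBetween G X (∁ Y)) (edgesBetween G (∁ X) Y))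
  where
  crossing : Bool → Bool → Bool
  crossing x y = (⌊ side x ≟F one ⌋ ∧ ⌊ side y ≟F two ⌋) ∨ (⌊ side x ≟F two ⌋ ∧ ⌊ side y ≟F one ⌋)
  from-X : ∀ e x y → (e ∧ crossing x y) ∧ x ≡ (e ∧ x) ∧ not y
  from-X false _     _     = refl
  from-X true  false false = refl
  from-X true  false true  = refl
  from-X true  true  false = refl
  from-X true  true  true  = refl
  from-∁X : ∀ e x y → (e ∧ crossing x y) ∧ not x ≡ (e ∧ not x) ∧ y
  from-∁X false _     _     = refl
  from-∁X true  true  false = refl
  from-∁X true  true  true  = refl
  from-∁X true  false false = refl
  from-∁X true  false true  = refl

p≤q⇒0≤q-p : ∀ {p q} → p ≤ q → 0ℚ ≤ q - p
p≤q⇒0≤q-p {p} {q} p≤q = subst (_≤ q - p) (+-inverseʳ p) (+-monoˡ-≤ (- p) p≤q)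

p<q⇒0<q-p : ∀ {p q} → p < q → 0ℚ < q - p
p<q⇒0<q-p {p} {q} p<q = subst (_< q - p) (+-inverseʳ p) (+-monoˡ-< (- p) p<q)

0≤q-p⇒p≤q : ∀ {p q} → 0ℚ ≤ q - p → p ≤ q
0≤q-p⇒p≤q {p} {q} 0≤q-p = subst₂ _≤_ (+-identityˡ p) (solve 2 (λ p q → (q :- p) :+ p := q) refl p q)
  (+-monoˡ-≤ p 0≤q-p)

infixr 5 _+⁺_
infixl 6 _*⁺_ _*⁺⁺_

_+⁺_ : ∀ {p q} → 0ℚ ≤ p → 0ℚ ≤ q → 0ℚ ≤ p + q
_+⁺_ = +-mono-≤

_*⁺_ : ∀ {p q} → 0ℚ ≤ p → 0ℚ ≤ q → 0ℚ ≤ p * q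
_*⁺_ {p} {q} 0≤p 0≤q = nonNegative⁻¹ _ {{nonNeg*nonNeg⇒nonNeg p {{nonNegative 0≤p}} q {{nonNegative 0≤q}}}}

_*⁺⁺_ : ∀ {p q} → 0ℚ < p → 0ℚ < q → 0ℚ < p * q
_*⁺⁺_ {p} {q} 0<p 0<q = positive⁻¹ _ {{pos*pos⇒pos p {{positive 0<p}} q {{positive 0<q}}}}

-- a = e(S,R), b = e(S,∁R), c = e(∁S,R), d = e(∁S,∁R), s = |S|, r = |R|.
record EdgeCountBounds (α ν n s r a b c d : ℚ) : Set where
  field
    total    : (α - ν) * (n * n) ≤ (a + b) + (c + d)
    from-∁S  : c + d ≤ (n - s) * (α * n)
    into-R   : a + c ≤ r * (α * n)
    S-to-∁R  : b ≤ (n - r) * (ν * n)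
    S-to-R   : a ≤ r * s
    ∁S-to-∁R : d ≤ (n - r) * (n - s)

module _ {α ν n s r a b c d : ℚ} (E : EdgeCountBounds α ν n s r a b c d) where
  open EdgeCountBounds E

  -- 4νn² − (b + c) is the sum of the slacks of into-R, total, from-∁S and twice S-to-∁R,
  -- plus αn(s + νn − r) + 2νnr + (1 − α)νn².
  cross-≤ : 0ℚ ≤ α → α ≤ 1ℚ → 0ℚ ≤ ν → 0ℚ ≤ n → 0ℚ ≤ r → r ≤ s + ν * n →
    b + c ≤ (ℕ→ℚ 4 * ν) * (n * n)
  cross-≤ 0≤α α≤1 0≤ν 0≤n 0≤r r≤s+νn = 0≤q-p⇒p≤q (subst (0ℚ ≤_) certificate
      (p≤q⇒0≤q-p into-R +⁺ p≤q⇒0≤q-p total +⁺ p≤q⇒0≤q-p from-∁S +⁺ ℕ→ℚ-nonNeg 2 *⁺ p≤q⇒0≤q-p S-to-∁R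
       +⁺ (0≤α *⁺ 0≤n) *⁺ p≤q⇒0≤q-p r≤s+νn +⁺ ((ℕ→ℚ-nonNeg 2 *⁺ 0≤ν) *⁺ 0≤n) *⁺ 0≤r
       +⁺ (p≤q⇒0≤q-p α≤1 *⁺ 0≤ν) *⁺ (0≤n *⁺ 0≤n)))
    where
    certificate : _ ≡ (ℕ→ℚ 4 * ν) * (n * n) - (b + c)
    certificate = solve 9 (λ α ν n s r a b c d →
       (r :* (α :* n) :- (a :+ c)) :+ (((a :+ b) :+ (c :+ d) :- (α :- ν) :* (n :* n)) :+
       (((n :- s) :* (α :* n) :- (c :+ d)) :+ ((con (ℕ→ℚ 2) :* ((n :- r) :* (ν :* n) :- b)) :+
       (((α :* n) :* ((s :+ ν :* n) :- r)) :+ ((((con (ℕ→ℚ 2) :* ν) :* n) :* r) :+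
       ((con 1ℚ :- α) :* ν) :* (n :* n))))))
       := (con (ℕ→ℚ 4) :* ν) :* (n :* n) :- (b :+ c)) refl α ν n s r a b c d

  -- s(r − τn) ≥ 0 is witnessed by the slacks of S-to-R, total, from-∁S and S-to-∁R together
  -- with (s − τn)(α − τ)n and n²(2(τα/8 − ν) + τ(α/4 − τ) + τα/2); then divide by s ≥ τn > 0.
  τn≤r : ∀ {τ} → 0ℚ ≤ α → 0ℚ < τ → 0ℚ ≤ ν → 0ℚ < n → 0ℚ ≤ r →
    τ ≤ α * (+ 1 / 4) → ν ≤ (τ * α) * (+ 1 / 8) → τ * n ≤ s → τ * n ≤ r
  τn≤r {τ} 0≤α 0<τ 0≤ν 0<n 0≤r τ≤α/4 ν≤τα/8 τn≤s =
    0≤q-p⇒p≤q (*-cancelˡ-≤-pos s {{positive 0<s}} (subst₂ _≤_ (sym (*-zeroʳ s)) certificate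
      (p≤q⇒0≤q-p S-to-R +⁺ p≤q⇒0≤q-p total +⁺ p≤q⇒0≤q-p from-∁S +⁺ p≤q⇒0≤q-p S-to-∁R
       +⁺ (0≤ν *⁺ 0≤n) *⁺ 0≤r +⁺ (p≤q⇒0≤q-p τn≤s *⁺ 0≤α-τ) *⁺ 0≤n
       +⁺ (0≤n *⁺ 0≤n) *⁺ (ℕ→ℚ-nonNeg 2 *⁺ p≤q⇒0≤q-p ν≤τα/8 +⁺ 0≤τ *⁺ p≤q⇒0≤q-p τ≤α/4
                           +⁺ (0≤τ *⁺ 0≤α) *⁺ nonNegative⁻¹ (+ 1 / 2)))))
    where
    0≤τ = <⇒≤ 0<τ
    0≤n = <⇒≤ 0<n
    0<s : 0ℚ < s
    0<s = <-≤-trans (0<τ *⁺⁺ 0<n) τn≤s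
    0≤α-τ : 0ℚ ≤ α - τ
    0≤α-τ = subst (0ℚ ≤_) (solve 2 (λ α τ → (α :* con (+ 1 / 4) :- τ) :+ α :* con (+ 3 / 4) := α :- τ) refl α τ)
      (p≤q⇒0≤q-p τ≤α/4 +⁺ 0≤α *⁺ nonNegative⁻¹ (+ 3 / 4))
    certificate : _ ≡ s * (r - τ * n)
    certificate = solve 10 (λ α ν τ n s r a b c d →
       (r :* s :- a) :+ (((a :+ b) :+ (c :+ d) :- (α :- ν) :* (n :* n)) :+
       (((n :- s) :* (α :* n) :- (c :+ d)) :+ (((n :- r) :* (ν :* n) :- b) :+
       (((ν :* n) :* r) :+ ((((s :- τ :* n) :* (α :- τ)) :* n) :+
       ((n :* n) :* ((con (ℕ→ℚ 2) :* ((τ :* α) :* con (+ 1 / 8) :- ν)) :+ ((τ :* (α :* con (+ 1 / 4) :- τ)) :+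
         (τ :* α) :* con (+ 1 / 2)))))))))
       := s :* (r :- τ :* n)) refl α ν τ n s r a b c d

  -- If x = n − r were below τn, the edge bounds would give αnx ≤ νn² + 2νnx + x², whereas
  -- x > n − s − νn ≥ (τ − ν)n; for τ ≤ α/4 and ν ≤ τα/8 this is impossible.  The certificate
  -- writes 0 as the positive (αn/2)(s + νn − r) plus nonnegative slacks.
  τn≤n-r : ∀ {τ} → 0ℚ < α → α ≤ 1ℚ → 0ℚ < τ → 0ℚ ≤ ν → 0ℚ < n → r ≤ n →
    τ ≤ α * (+ 1 / 4) → ν ≤ (τ * α) * (+ 1 / 8) → s ≤ (1ℚ - τ) * n → r < s + ν * n →
    τ * n ≤ n - r
  τn≤n-r {τ} 0<α α≤1 0<τ 0≤ν 0<n r≤n τ≤α/4 ν≤τα/8 s≤[1-τ]n r<s+νn with τ * n ≤? n - r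
  ... | yes τn≤n-r = τn≤n-r
  ... | no  τn≰n-r = ⊥-elim (<-irrefl refl (subst (0ℚ <_) certificate
      (+-mono-<-≤ ((0<α *⁺⁺ 0<n) *⁺⁺ positive⁻¹ (+ 1 / 2) *⁺⁺ p<q⇒0<q-p r<s+νn) slacks)))
    where
    0≤α = <⇒≤ 0<α
    0≤τ = <⇒≤ 0<τ
    0≤n = <⇒≤ 0<n
    0≤x : 0ℚ ≤ n - r
    0≤x = p≤q⇒0≤q-p r≤n
    0≤1-τ : 0ℚ ≤ 1ℚ - τ
    0≤1-τ = subst (0ℚ ≤_)
      (solve 2 (λ α τ → (α :* con (+ 1 / 4) :- τ) :+ ((con 1ℚ :- α) :* con (+ 1 / 4) :+ con (+ 3 / 4)) := con 1ℚ :- τ) refl α τ)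
      (p≤q⇒0≤q-p τ≤α/4 +⁺ p≤q⇒0≤q-p α≤1 *⁺ nonNegative⁻¹ (+ 1 / 4) +⁺ nonNegative⁻¹ (+ 3 / 4))
    0≤α/8-ν : 0ℚ ≤ α * (+ 1 / 8) - ν
    0≤α/8-ν = subst (0ℚ ≤_)
      (solve 3 (λ α τ ν → ((τ :* α) :* con (+ 1 / 8) :- ν) :+ (α :* con (+ 1 / 8)) :* (con 1ℚ :- τ) := α :* con (+ 1 / 8) :- ν) refl α τ ν)
      (p≤q⇒0≤q-p ν≤τα/8 +⁺ (0≤α *⁺ nonNegative⁻¹ (+ 1 / 8)) *⁺ 0≤1-τ)
    slacks : 0ℚ ≤ _
    slacks = p≤q⇒0≤q-p total +⁺ p≤q⇒0≤q-p into-R +⁺ p≤q⇒0≤q-p S-to-∁R +⁺ p≤q⇒0≤q-p ∁S-to-∁R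
      +⁺ 0≤x *⁺ p≤q⇒0≤q-p (<⇒≤ r<s+νn) +⁺ 0≤x *⁺ p≤q⇒0≤q-p (<⇒≤ (≰⇒> τn≰n-r))
      +⁺ ((ℕ→ℚ-nonNeg 2 *⁺ 0≤x) *⁺ 0≤n) *⁺ 0≤α/8-ν +⁺ (0≤x *⁺ 0≤n) *⁺ p≤q⇒0≤q-p τ≤α/4
      +⁺ ((0≤α *⁺ 0≤n) *⁺ nonNegative⁻¹ (+ 1 / 2)) *⁺ p≤q⇒0≤q-p s≤[1-τ]n
      +⁺ ((nonNegative⁻¹ 1ℚ +⁺ 0≤α *⁺ nonNegative⁻¹ (+ 1 / 2)) *⁺ (0≤n *⁺ 0≤n)) *⁺ p≤q⇒0≤q-p ν≤τα/8
      +⁺ ((((0≤τ *⁺ 0≤α) *⁺ 0≤n) *⁺ 0≤n) *⁺ nonNegative⁻¹ (+ 1 / 16)) *⁺ p≤q⇒0≤q-p α≤1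
      +⁺ (((0≤τ *⁺ 0≤α) *⁺ 0≤n) *⁺ 0≤n) *⁺ nonNegative⁻¹ (+ 5 / 16)
    certificate : _ ≡ 0ℚ
    certificate = solve 10 (λ α ν τ n s r a b c d →
      ((((α :* n) :* con (+ 1 / 2)) :* ((s :+ ν :* n) :- r)) :+
       ((((a :+ b) :+ (c :+ d)) :- (α :- ν) :* (n :* n)) :+
        ((r :* (α :* n) :- (a :+ c)) :+
         (((n :- r) :* (ν :* n) :- b) :+
          (((n :- r) :* (n :- s) :- d) :+
           (((n :- r) :* ((s :+ ν :* n) :- r)) :+
            (((n :- r) :* (τ :* n :- (n :- r))) :+
             ((((con (ℕ→ℚ 2) :* (n :- r)) :* n) :* (α :* con (+ 1 / 8) :- ν)) :+
              ((((n :- r) :* n) :* (α :* con (+ 1 / 4) :- τ)) :+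
               ((((α :* n) :* con (+ 1 / 2)) :* ((con 1ℚ :- τ) :* n :- s)) :+
                ((((con 1ℚ :+ α :* con (+ 1 / 2)) :* (n :* n)) :* ((τ :* α) :* con (+ 1 / 8) :- ν)) :+
                 ((((((τ :* α) :* n) :* n) :* con (+ 1 / 16)) :* (con 1ℚ :- α)) :+
                  ((((τ :* α) :* n) :* n) :* con (+ 5 / 16))))))))))))))
      := con 0ℚ) refl α ν τ n s r a b c d

x≤[1-τ]n⇒τn≤n-x : ∀ τ n x → x ≤ (1ℚ - τ) * n → τ * n ≤ n - x
x≤[1-τ]n⇒τn≤n-x τ n x x≤[1-τ]n = 0≤q-p⇒p≤q (subst (0ℚ ≤_)
  (solve 3 (λ τ n x → (con 1ℚ :- τ) :* n :- x := (n :- x) :- τ :* n) refl τ n x) (p≤q⇒0≤q-p x≤[1-τ]n))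

module _ {n : ℕ} (G : Digraph n) (ν : ℚ) (S : VSet n) where

  private
    n̂ = ℕ→ℚ n
    R = RN⁺ G ν S
    ∣_∣ : VSet n → ℚ
    ∣ X ∣ = ℕ→ℚ (setSize X)
    e : VSet n → VSet n → ℚ
    e X Y = ℕ→ℚ (edgesBetween G X Y)

  edgeCountBounds : ∀ {α} → (α - ν) * (n̂ * n̂) ≤ ℕ→ℚ (edgeCount G) → MaxSemiDegLe G (α * n̂) →
    EdgeCountBounds α ν n̂ ∣ S ∣ ∣ R ∣ (e S R) (e S (∁ R)) (e (∁ S) R) (e (∁ S) (∁ R))
  edgeCountBounds {α} e≥ Δ⁰≤ = record
    { total    = subst ((α - ν) * (n̂ * n̂) ≤_) total-≡ e≥
    ; from-∁S  = subst₂ (λ x y → x ≤ y * (α * n̂)) (edgesFrom-split G (∁ S) R) (ℕ→ℚ-count-complement S)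
                   (edgesFrom-≤ G Δ⁰≤ (∁ S))
    ; into-R   = subst (_≤ ∣ R ∣ * (α * n̂)) (edgesInto-split G S R) (edgesInto-≤ G Δ⁰≤ R)
    ; S-to-∁R  = subst (λ y → e S (∁ R) ≤ y * (ν * n̂)) (ℕ→ℚ-count-complement R)
                   (edgesBetween-≤ G S (∁ R) (outside-RN⁺ G ν S))
    ; S-to-R   = edgesBetween-≤-product G S R
    ; ∁S-to-∁R = subst₂ (λ x y → e (∁ S) (∁ R) ≤ x * y) (ℕ→ℚ-count-complement R) (ℕ→ℚ-count-complement S)
                   (edgesBetween-≤-product G (∁ S) (∁ R))
    }
    where
    total-≡ : ℕ→ℚ (edgeCount G) ≡ (e S R + e S (∁ R)) + (e (∁ S) R + e (∁ S) (∁ R))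
    total-≡ = begin
      ℕ→ℚ (edgeCount G)                                         ≡⟨ edgeCount-split G S ⟩
      ℕ→ℚ (edgesFrom G S) + ℕ→ℚ (edgesFrom G (∁ S))            ≡⟨ cong₂ _+_ (edgesFrom-split G S R)
                                                                                (edgesFrom-split G (∁ S) R) ⟩
      (e S R + e S (∁ R)) + (e (∁ S) R + e (∁ S) (∁ R))         ∎
      where open ≡-Reasoning

NonExpanding : ∀ {n} → Digraph n → ℚ → ℚ → VSet n → Set
NonExpanding {n} G ν τ S =
  τ * ℕ→ℚ n ≤ ℕ→ℚ (setSize S) × ℕ→ℚ (setSize S) ≤ (1ℚ - τ) * ℕ→ℚ n ×
  ℕ→ℚ (setSize (RN⁺ G ν S)) < ℕ→ℚ (setSize S) + ν * ℕ→ℚ n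

nonExpanding? : ∀ {n} (G : Digraph n) ν τ S → Dec (NonExpanding G ν τ S)
nonExpanding? {n} G ν τ S = (τ * ℕ→ℚ n ≤? ℕ→ℚ (setSize S)) ×-dec (ℕ→ℚ (setSize S) ≤? (1ℚ - τ) * ℕ→ℚ n)
  ×-dec (ℕ→ℚ (setSize (RN⁺ G ν S)) <? ℕ→ℚ (setSize S) + ν * ℕ→ℚ n)

nonExpanding-resp : ∀ {n} (G : Digraph n) ν τ {S S′ : VSet n} → (∀ v → S v ≡ S′ v) →
  NonExpanding G ν τ S → NonExpanding G ν τ S′
nonExpanding-resp {n} G ν τ S≗S′ =
  subst₂ (λ s r → τ * n̂ ≤ ℕ→ℚ s × ℕ→ℚ s ≤ (1ℚ - τ) * n̂ × ℕ→ℚ r < ℕ→ℚ s + ν * n̂)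
  (count-cong S≗S′)
  (count-cong (λ v → cong (λ k → ⌊ ν * n̂ ≤? ℕ→ℚ k ⌋) (count-cong (λ a → cong (adj G a v ∧_) (S≗S′ a)))))
  where n̂ = ℕ→ℚ n

¬robust⇒nonExpanding : ∀ {n} (G : Digraph n) ν τ → ¬ RobustOutexpander G ν τ → Σ (VSet n) (NonExpanding G ν τ)
¬robust⇒nonExpanding {n} G ν τ ¬robust = decide (anySubset? (λ p → nonExpanding? G ν τ (lookup p)))
  where
  decide : Dec (Σ _ λ p → NonExpanding G ν τ (lookup p)) → Σ (VSet n) (NonExpanding G ν τ)
  decide (yes (p , nonExp)) = lookup p , nonExp
  decide (no ∄nonExp) = ⊥-elim (¬robust λ S τn≤s s≤[1-τ]n → ≮⇒≥ λ r<s+νn →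
    ∄nonExp (tabulate S , nonExpanding-resp G ν τ (λ v → sym (lookup∘tabulate S v)) (τn≤s , s≤[1-τ]n , r<s+νn)))

nonExpanding⇒4Partition : ∀ {n} (G : Digraph n) {α τ ν} →
  0ℚ < α → α ≤ 1ℚ → 0ℚ < τ → τ ≤ α * (+ 1 / 4) → 0ℚ < ν → ν ≤ (τ * α) * (+ 1 / 8) → 0ℚ < ℕ→ℚ n →
  (α - ν) * (ℕ→ℚ n * ℕ→ℚ n) ≤ ℕ→ℚ (edgeCount G) → MaxSemiDegLe G (α * ℕ→ℚ n) →
  ∀ S → NonExpanding G ν τ S → Is4Partition G τ (ℕ→ℚ 4 * ν) (quadrants S (RN⁺ G ν S))
nonExpanding⇒4Partition {n} G {α} {τ} {ν} 0<α α≤1 0<τ τ≤α/4 0<ν ν≤τα/8 0<n e≥ Δ⁰≤ S (τn≤s , s≤[1-τ]n , r<s+νn) =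
  cross , rows , cols
  where
  R = RN⁺ G ν S
  E = edgeCountBounds G ν S e≥ Δ⁰≤
  0≤r = ℕ→ℚ-nonNeg (setSize R)
  resize : ∀ {X Y : VSet n} → (∀ v → X v ≡ Y v) → τ * ℕ→ℚ n ≤ ℕ→ℚ (setSize Y) → τ * ℕ→ℚ n ≤ ℕ→ℚ (setSize X)
  resize X≗Y = subst (λ k → τ * ℕ→ℚ n ≤ ℕ→ℚ k) (sym (count-cong X≗Y))
  cross : ℕ→ℚ (crossEdges G (quadrants S R)) ≤ (ℕ→ℚ 4 * ν) * (ℕ→ℚ n * ℕ→ℚ n)
  cross = subst (_≤ (ℕ→ℚ 4 * ν) * (ℕ→ℚ n * ℕ→ℚ n)) (sym (crossEdges-quadrants G S R))
    (cross-≤ E (<⇒≤ 0<α) α≤1 (<⇒≤ 0<ν) (<⇒≤ 0<n) 0≤r (<⇒≤ r<s+νn))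
  rows : ∀ i → τ * ℕ→ℚ n ≤ ℕ→ℚ (setSize (rowPart (quadrants S R) i))
  rows zero       = resize (side≟one ∘ S) τn≤s
  rows (suc zero) = resize (side≟two ∘ S) (subst (τ * ℕ→ℚ n ≤_) (sym (ℕ→ℚ-count-complement S))
    (x≤[1-τ]n⇒τn≤n-x τ (ℕ→ℚ n) _ s≤[1-τ]n))
  cols : ∀ j → τ * ℕ→ℚ n ≤ ℕ→ℚ (setSize (colPart (quadrants S R) j))
  cols zero       = resize (side≟one ∘ R)
    (τn≤r E (<⇒≤ 0<α) 0<τ (<⇒≤ 0<ν) 0<n 0≤r τ≤α/4 ν≤τα/8 τn≤s)
  cols (suc zero) = resize (side≟two ∘ R) (subst (τ * ℕ→ℚ n ≤_) (sym (ℕ→ℚ-count-complement R))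
    (τn≤n-r E 0<α α≤1 0<τ (<⇒≤ 0<ν) 0<n (ℕ→ℚ-mono (count≤size R)) τ≤α/4 ν≤τα/8 s≤[1-τ]n r<s+νn))

lemma3p6 : Σ ℚ λ α₀ → 0ℚ < α₀ × ((α : ℚ) → 0ℚ < α → α ≤ α₀ →
    Σ ℚ λ τ₀ → 0ℚ < τ₀ × ((τ : ℚ) → 0ℚ < τ → τ ≤ τ₀ →
      Σ ℚ λ ν₀ → 0ℚ < ν₀ × ((ν : ℚ) → 0ℚ < ν → ν ≤ ν₀ →
        Σ ℕ λ n₀ → (n : ℕ) → n₀ ≤ℕ n → (G : Digraph n) →
          (α - ν) * (ℕ→ℚ n * ℕ→ℚ n) ≤ ℕ→ℚ (edgeCount G) →
          MaxSemiDegLe G (α * ℕ→ℚ n) →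
          (RobustOutexpander G ν τ → ⊥') →
          Σ (FourPartition n) λ P → Is4Partition G τ (ℕ→ℚ 4 * ν) P)))
lemma3p6 =
  1ℚ , positive⁻¹ 1ℚ , λ α 0<α α≤1 →
  α * (+ 1 / 4) , 0<α *⁺⁺ positive⁻¹ (+ 1 / 4) , λ τ 0<τ τ≤α/4 →
  (τ * α) * (+ 1 / 8) , 0<τ *⁺⁺ 0<α *⁺⁺ positive⁻¹ (+ 1 / 8) , λ ν 0<ν ν≤τα/8 →
  1 , λ n 1≤n G e≥ Δ⁰≤ ¬robust →
    let S , nonExp = ¬robust⇒nonExpanding G ν τ ¬robust
        0<n = <-≤-trans (positive⁻¹ 1ℚ) (ℕ→ℚ-mono 1≤n)
    in quadrants S (RN⁺ G ν S) ,
       nonExpanding⇒4Partition G 0<α α≤1 0<τ τ≤α/4 0<ν ν≤τα/8 0<n e≥ Δ⁰≤ S nonExp
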